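{- For every integer $k\ge1$, $$Mcut(P_{2k,k})=\begin{cases}\frac{4}{7k-2} & \text{if } 4\mid k,\\[2pt] \frac{4(7k-2)}{(7k-4)\,7k} & \text{if } 4\nmid k \text{ and } 2\mid k,\\[2pt] \frac{4(7k-2)}{(7k-3)(7k-1)} & \text{if } 2\nmid k.\end{cases}$$
   Context: $P_{n,k}$ ($n,k\ge1$) is the weighted graph on vertices $x_1,\dots,x_{n+k}$ whose weighted adjacency matrix has entries $w_{ij}=1$ if $|i-j|=1$, $w_{ii}=1$ if $n+1\le i\le n+k$, and $0$ otherwise (loops of weight 1 at $x_{n+1},\dots,x_{n+k}$). Degrees are $d_i=\sum_j w_{ij}$. For $S\subseteq V$, $vol(S)=\sum_{i\in S}d_i$; for disjoint $S,T$, $cut(S,T)=\sum_{i\in S,j\in T}w_{ij}$; $Ncut(S,T)=cut(S,T)\left(\frac1{vol(S)}+\frac1{vol(T)}\right)$; $Mcut(G)=\min\{Ncut(S,V\setminus S):\emptyset\ne S\subsetneq V\}$. -}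

module Defs where

open import Data.Bool using (Bool; true; false; _∧_; not; if_then_else_)
open import Data.Nat as ℕ using (ℕ; zero; suc; _≤ᵇ_; _≡ᵇ_; ∣_-_∣)
open import Data.Fin using (Fin; toℕ)
open import Data.Fin.Subset using (Subset; Nonempty; ∁)
open import Data.Vec using (lookup)
open import Data.List using (List; map; allFin)
open import Data.Nat.ListAction using (sum)
open import Data.Integer using (ℤ; +_)
open import Data.Rational using (ℚ; _/_; 0ℚ; _+_; _*_; _≤_)
open import Data.Product using (Σ; _×_; _,_)
open import Relation.Binary.PropositionalEquality using (_≡_)
open import Relation.Nullary using (¬_)

record WGraph : Set where
  field
    m : ℕ
    w : Fin m → Fin m → ℕ
open WGraph public

Σᵥ : ∀ {m} → (Fin m → ℕ) → ℕ
Σᵥ {m} f = sum (map f (allFin m))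

_∈ᵇ_ : ∀ {m} → Fin m → Subset m → Bool
i ∈ᵇ S = lookup S i

-- Total rational division a/b; convention a/0 = 0 (never used with b = 0 here).
frac : ℤ → ℕ → ℚ
frac a zero    = 0ℚ
frac a (suc b) = a / suc b

deg : (G : WGraph) → Fin (m G) → ℕ
deg G i = Σᵥ (λ j → w G i j)

vol : (G : WGraph) → Subset (m G) → ℕ
vol G S = Σᵥ (λ i → if i ∈ᵇ S then deg G i else 0)

cut : (G : WGraph) → Subset (m G) → Subset (m G) → ℕ
cut G S T = Σᵥ (λ i → Σᵥ (λ j → if i ∈ᵇ S ∧ j ∈ᵇ T then w G i j else 0))

Ncut : (G : WGraph) → Subset (m G) → Subset (m G) → ℚ
Ncut G S T = (+ cut G S T / 1) * (frac (+ 1) (vol G S) + frac (+ 1) (vol G T))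

Proper : ∀ {m} → Subset m → Set
Proper S = Nonempty S × Nonempty (∁ S)

IsMcut : WGraph → ℚ → Set
IsMcut G q =
  Σ (Subset (m G)) (λ S → Proper S × Ncut G S (∁ S) ≡ q)
  × (∀ (S : Subset (m G)) → Proper S → q ≤ Ncut G S (∁ S))

-- P_{n,k}: vertices x_1..x_{n+k} (here Fin (n+k), x_i ↦ i-1),
-- w_ij = 1 if |i-j| = 1; w_ii = 1 if n+1 ≤ i ≤ n+k; 0 otherwise.
P : ℕ → ℕ → WGraph
P n k = record { m = n ℕ.+ k ; w = wt }
  where
  wt : Fin (n ℕ.+ k) → Fin (n ℕ.+ k) → ℕ
  wt i j = if ∣ toℕ i - toℕ j ∣ ≡ᵇ 1 then 1
           else if (toℕ i ≡ᵇ toℕ j) ∧ (n ≤ᵇ toℕ i) then 1 else 0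

module Submission where

-- Index the vertices of P n k by 0, …, n + k − 1 and read a subset S as a Boolean
-- mask.  Then vol S sums the degrees d_x = [x > 0] + [x < n + k − 1] + [x ≥ n]
-- over the mask, and cut(S, V∖S) counts the path edges along which the mask
-- changes value.  So for a proper S, with a = vol S, b = vol (V∖S) and
-- c = cut(S, V∖S): a + b = W := vol V, c ≥ 1, and if c = 1 then S or V∖S is an
-- initial segment {x_1, …, x_j}, of volume (j − 1) + j + (j ∸ n) (CutProfile).
-- As Ncut(S, V∖S) = cW/(ab), a prefix realises Mcut as soon as it is the most
-- balanced single-edge cut and W² ≤ 8ab; cuts with c ≥ 2 edges then lose by
-- AM-GM (mcut-most-balanced).  For n = 2k we have W = 7k − 2, the first j ≤ 2k
-- vertices have odd volume 2j − 1 and longer prefixes exceed W/2.  Hence the best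
-- prefix splits W into equal halves when 4 ∣ k, into 2t + 1 and 2t + 3 when
-- k ≡ 2 (mod 4) (halves would be even), and into parts differing by one when k
-- is odd; AM-GM together with the parity of W bounds every other single-edge cut.
-- The theorem follows by cases on k mod 4.

open import Defs
open import Data.Nat using (ℕ; _≤_; _*_; _∸_)
open import Data.Nat.Divisibility using (_∣_)
open import Data.Integer using (+_)
open import Data.Product using (_×_)
open import Relation.Nullary using (¬_)

open import Algebra.Properties.CommutativeSemigroup using (interchange)
open import Data.Bool using (Bool; true; false; _∧_; not; if_then_else_; T)
open import Data.Bool.Properties using (not-involutive)
open import Data.Empty using (⊥; ⊥-elim)
open import Data.Fin using (Fin; toℕ; fromℕ<) renaming (zero to fzero; suc to fsuc)
open import Data.Fin.Properties using (toℕ<n; toℕ-fromℕ<)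
open import Data.Fin.Subset using (Subset; ∁; Nonempty; _∈_)
import Data.Integer as ℤ
import Data.Integer.Properties as ℤP
import Data.List as List
open import Data.List.Properties using (map-tabulate)
open import Data.Nat using (zero; suc; _+_; _<_; _<?_; z≤n; s≤s; z<s; s<s; pred; >-nonZero; _≤ᵇ_; _<ᵇ_; _≡ᵇ_; ∣_-_∣)
open import Data.Nat.Divisibility using (divides; ∣⇒≤; ∣m+n∣m⇒∣n; n∣m*n)
open import Data.Nat.ListAction using (sum)
open import Data.Nat.Properties
open import Data.Nat.Tactic.RingSolver using (solve-∀)
open import Data.Product using (Σ; _,_; proj₁; proj₂)
open import Data.Rational as ℚ using (ℚ; toℚᵘ)
import Data.Rational.Properties as ℚP
open import Data.Rational.Unnormalised as ᵘ using (ℚᵘ; mkℚᵘ)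
import Data.Rational.Unnormalised.Properties as ᵘP
open import Data.Sum using (_⊎_; inj₁; inj₂)
open import Data.Vec using ([]; _∷_; lookup; tabulate)
open import Data.Vec.Properties using (lookup-map; []=⇒lookup; lookup⇒[]=)
open import Relation.Binary.PropositionalEquality
open import Relation.Nullary using (yes; no)

sumTo : ℕ → (ℕ → ℕ) → ℕ
sumTo zero    f = 0
sumTo (suc m) f = f 0 + sumTo m (λ i → f (suc i))

Σᵥ≡sumTo : ∀ m (f : Fin m → ℕ) (g : ℕ → ℕ) → (∀ i → f i ≡ g (toℕ i)) → Σᵥ f ≡ sumTo m g
Σᵥ≡sumTo m f g f≗g = trans (cong sum (map-tabulate (λ i → i) f)) (sum-tabulate m f g f≗g)
  where
  sum-tabulate : ∀ m (f : Fin m → ℕ) (g : ℕ → ℕ) → (∀ i → f i ≡ g (toℕ i)) → sum (List.tabulate f) ≡ sumTo m g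
  sum-tabulate zero    f g f≗g = refl
  sum-tabulate (suc m) f g f≗g =
    cong₂ _+_ (f≗g fzero) (sum-tabulate m (λ i → f (fsuc i)) (λ i → g (suc i)) (λ i → f≗g (fsuc i)))

sumTo-cong : ∀ m {f g : ℕ → ℕ} → (∀ i → i < m → f i ≡ g i) → sumTo m f ≡ sumTo m g
sumTo-cong zero    f≗g = refl
sumTo-cong (suc m) f≗g = cong₂ _+_ (f≗g 0 (s≤s z≤n)) (sumTo-cong m (λ i i<m → f≗g (suc i) (s≤s i<m)))

sumTo-zero : ∀ m {f : ℕ → ℕ} → (∀ i → f i ≡ 0) → sumTo m f ≡ 0
sumTo-zero zero    f≗0 = refl
sumTo-zero (suc m) f≗0 = cong₂ _+_ (f≗0 0) (sumTo-zero m (λ i → f≗0 (suc i)))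

sumTo-+ : ∀ m (f g : ℕ → ℕ) → sumTo m (λ i → f i + g i) ≡ sumTo m f + sumTo m g
sumTo-+ zero    f g = refl
sumTo-+ (suc m) f g =
  trans (cong (λ r → f 0 + g 0 + r) (sumTo-+ m _ _)) (interchange +-commutativeSemigroup (f 0) (g 0) _ _)

sumTo-snoc : ∀ m (f : ℕ → ℕ) → sumTo (suc m) f ≡ sumTo m f + f m
sumTo-snoc zero    f = +-comm (f 0) 0
sumTo-snoc (suc m) f =
  trans (cong (λ r → f 0 + r) (sumTo-snoc m (λ i → f (suc i)))) (sym (+-assoc (f 0) _ _))

term≤sumTo : ∀ {m} (f : ℕ → ℕ) x → x < m → f x ≤ sumTo m f
term≤sumTo {suc m} f zero    _         = m≤m+n _ _
term≤sumTo {suc m} f (suc x) (s≤s x<m) = ≤-trans (term≤sumTo (λ y → f (suc y)) x x<m) (m≤n+m _ _)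

sumTo-const1 : ∀ m → sumTo m (λ _ → 1) ≡ m
sumTo-const1 zero    = refl
sumTo-const1 (suc m) = cong suc (sumTo-const1 m)

sumTo-below : ∀ M j (f : ℕ → ℕ) → j ≤ M → sumTo M (λ x → if x <ᵇ j then f x else 0) ≡ sumTo j f
sumTo-below M       zero    f _         = sumTo-zero M (λ _ → refl)
sumTo-below (suc M) (suc j) f (s≤s j≤M) = cong (λ r → f 0 + r) (sumTo-below M j (λ x → f (suc x)) j≤M)

sumTo-split : ∀ M (s s' : ℕ → Bool) (f : ℕ → ℕ) → (∀ x → x < M → s' x ≡ not (s x)) →
  sumTo M (λ x → if s x then f x else 0) + sumTo M (λ x → if s' x then f x else 0) ≡ sumTo M f
sumTo-split M s s' f s'≗¬s = trans (sym (sumTo-+ M _ _)) (sumTo-cong M pointwise)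
  where
  pointwise : ∀ x → x < M → (if s x then f x else 0) + (if s' x then f x else 0) ≡ f x
  pointwise x x<M rewrite s'≗¬s x x<M with s x
  ... | true  = +-identityʳ (f x)
  ... | false = refl

<ᵇ-true : ∀ {m n} → m < n → (m <ᵇ n) ≡ true
<ᵇ-true {m} {n} m<n with m <ᵇ n | <⇒<ᵇ m<n
... | true | _ = refl

<ᵇ-false : ∀ {m n} → n ≤ m → (m <ᵇ n) ≡ false
<ᵇ-false {m} {n} n≤m with m <ᵇ n in eq
... | false = refl
... | true  = ⊥-elim (≤⇒≯ n≤m (<ᵇ⇒< m n (subst T (sym eq) _)))

ind : Bool → ℕ
ind true  = 1
ind false = 0

weight : ℕ → ℕ → ℕ → ℕ
weight n x y = if ∣ x - y ∣ ≡ᵇ 1 then 1 else if (x ≡ᵇ y) ∧ (n ≤ᵇ x) then 1 else 0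

left : ℕ → (ℕ → ℕ) → ℕ
left zero    g = 0
left (suc x) g = g x

right : ℕ → ℕ → (ℕ → ℕ) → ℕ
right x m g = if suc x <ᵇ m then g (suc x) else 0

sum-diagonal : ∀ m x (g : ℕ → ℕ) → x < m → sumTo m (λ y → if x ≡ᵇ y then g y else 0) ≡ g x
sum-diagonal (suc m) zero    g _         = trans (cong (λ r → g 0 + r) (sumTo-zero m (λ _ → refl))) (+-identityʳ _)
sum-diagonal (suc m) (suc x) g (s≤s x<m) = sum-diagonal m x (λ y → g (suc y)) x<m

sum-neighbours : ∀ m x (g : ℕ → ℕ) → x < m →
  sumTo m (λ y → if ∣ x - y ∣ ≡ᵇ 1 then g y else 0) ≡ left x g + right x m g
sum-neighbours (suc zero)    zero    g _         = refl
sum-neighbours (suc (suc m)) zero    g _         = trans (cong (λ r → g 1 + r) (sumTo-zero m (λ _ → refl))) (+-identityʳ (g 1))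
sum-neighbours (suc m)       (suc x) g (s≤s x<m) = begin
  (if x ≡ᵇ 0 then g 0 else 0) + sumTo m (λ y → if ∣ x - y ∣ ≡ᵇ 1 then g (suc y) else 0)
    ≡⟨ cong (λ r → (if x ≡ᵇ 0 then g 0 else 0) + r) (sum-neighbours m x (λ y → g (suc y)) x<m) ⟩
  (if x ≡ᵇ 0 then g 0 else 0) + (left x (λ y → g (suc y)) + right x m (λ y → g (suc y)))
    ≡⟨ sym (+-assoc (if x ≡ᵇ 0 then g 0 else 0) _ _) ⟩
  (if x ≡ᵇ 0 then g 0 else 0) + left x (λ y → g (suc y)) + right x m (λ y → g (suc y))
    ≡⟨ cong (λ r → r + right x m (λ y → g (suc y))) (left-shift x) ⟩
  g x + right x m (λ y → g (suc y)) ∎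
  where
  open ≡-Reasoning
  left-shift : ∀ x → (if x ≡ᵇ 0 then g 0 else 0) + left x (λ y → g (suc y)) ≡ g x
  left-shift zero    = +-identityʳ (g 0)
  left-shift (suc x) = refl

-- Splitting the weight into its path part and its loop part (never both nonzero).
weight-split : ∀ n x y (c : Bool) →
  (if c then weight n x y else 0)
    ≡ (if ∣ x - y ∣ ≡ᵇ 1 then ind c else 0) + (if x ≡ᵇ y then ind (c ∧ (n ≤ᵇ x)) else 0)
weight-split n x y c with ∣ x - y ∣ ≡ᵇ 1 in adjacent | x ≡ᵇ y in diagonal | c | n ≤ᵇ x
... | true  | true  | _     | _     = ⊥-elim (not-both x y adjacent diagonal)
  where
  not-both : ∀ x y → (∣ x - y ∣ ≡ᵇ 1) ≡ true → (x ≡ᵇ y) ≡ true → ⊥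
  not-both zero    zero    () _
  not-both (suc x) (suc y) a  d = not-both x y a d
... | true  | false | true  | _     = refl
... | true  | false | false | _     = refl
... | false | true  | true  | true  = refl
... | false | true  | true  | false = refl
... | false | true  | false | _     = refl
... | false | false | true  | _     = refl
... | false | false | false | _     = refl

row-sum : ∀ n m x (c : ℕ → Bool) → x < m →
  sumTo m (λ y → if c y then weight n x y else 0)
    ≡ left x (λ y → ind (c y)) + right x m (λ y → ind (c y)) + ind (c x ∧ (n ≤ᵇ x))
row-sum n m x c x<m = begin
  sumTo m (λ y → if c y then weight n x y else 0)
    ≡⟨ sumTo-cong m (λ y _ → weight-split n x y (c y)) ⟩
  sumTo m (λ y → path y + loop y)
    ≡⟨ sumTo-+ m path loop ⟩
  sumTo m path + sumTo m loop
    ≡⟨ cong₂ _+_ (sum-neighbours m x (λ y → ind (c y)) x<m)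
                 (sum-diagonal m x (λ y → ind (c y ∧ (n ≤ᵇ x))) x<m) ⟩
  left x (λ y → ind (c y)) + right x m (λ y → ind (c y)) + ind (c x ∧ (n ≤ᵇ x)) ∎
  where
  open ≡-Reasoning
  path loop : ℕ → ℕ
  path y = if ∣ x - y ∣ ≡ᵇ 1 then ind (c y) else 0
  loop y = if x ≡ᵇ y then ind (c y ∧ (n ≤ᵇ x)) else 0

degree : ℕ → ℕ → ℕ → ℕ
degree n m x = left x (λ _ → 1) + right x m (λ _ → 1) + ind (n ≤ᵇ x)

deg-formula : ∀ n k (i : Fin (n + k)) → deg (P n k) i ≡ degree n (n + k) (toℕ i)
deg-formula n k i = trans (Σᵥ≡sumTo (n + k) _ (weight n (toℕ i)) (λ _ → refl))
                          (row-sum n (n + k) (toℕ i) (λ _ → true) (toℕ<n i))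

mask : ∀ {m} → Subset m → ℕ → Bool
mask []      _       = false
mask (b ∷ S) zero    = b
mask (b ∷ S) (suc x) = mask S x

mask-lookup : ∀ {m} (S : Subset m) (i : Fin m) → lookup S i ≡ mask S (toℕ i)
mask-lookup (b ∷ S) fzero    = refl
mask-lookup (b ∷ S) (fsuc i) = mask-lookup S i

mask-∁ : ∀ {m} (S : Subset m) x → x < m → mask (∁ S) x ≡ not (mask S x)
mask-∁ (b ∷ S) zero    _         = refl
mask-∁ (b ∷ S) (suc x) (s≤s x<m) = mask-∁ S x x<m

mask-∈ : ∀ {m} (S : Subset m) {i} → i ∈ S → mask S (toℕ i) ≡ true
mask-∈ S {i} i∈S = trans (sym (mask-lookup S i)) ([]=⇒lookup i∈S)

mask-∉ : ∀ {m} (S : Subset m) {i} → i ∈ ∁ S → mask S (toℕ i) ≡ false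
mask-∉ S {i} i∉S = trans (sym (not-involutive (mask S (toℕ i))))
  (cong not (trans (sym (mask-∁ S (toℕ i) (toℕ<n i))) (mask-∈ (∁ S) i∉S)))

vol-formula : ∀ n k (S : Subset (n + k)) →
  vol (P n k) S ≡ sumTo (n + k) (λ x → if mask S x then degree n (n + k) x else 0)
vol-formula n k S = Σᵥ≡sumTo (n + k) _ _
  (λ i → cong₂ (λ b v → if b then v else 0) (mask-lookup S i) (deg-formula n k i))

sum-left : ∀ m (h : ℕ → ℕ → ℕ) → sumTo m (λ x → left x (h x)) ≡ sumTo (pred m) (λ x → h (suc x) x)
sum-left zero    h = refl
sum-left (suc m) h = refl

sum-right : ∀ m (h : ℕ → ℕ → ℕ) → sumTo m (λ x → right x m (h x)) ≡ sumTo (pred m) (λ x → h x (suc x))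
sum-right zero          h = refl
sum-right (suc zero)    h = refl
sum-right (suc (suc m)) h = cong (λ r → h 0 1 + r) (sum-right (suc m) (λ x y → h (suc x) (suc y)))

crossing : Bool → Bool → ℕ
crossing a b = ind (b ∧ not a) + ind (a ∧ not b)

crossings : (ℕ → Bool) → ℕ → ℕ
crossings s m = sumTo m (λ i → crossing (s i) (s (suc i)))

-- cut(S, V∖S) counts the path edges leaving S (loops never cross).
cut-formula : ∀ n k (S : Subset (n + k)) → cut (P n k) S (∁ S) ≡ crossings (mask S) (pred (n + k))
cut-formula n k S = begin
  cut (P n k) S (∁ S)
    ≡⟨ Σᵥ≡sumTo M _ (λ x → sumTo M (λ y → if s x ∧ not (s y) then weight n x y else 0))
         (λ i → Σᵥ≡sumTo M _ _ (λ j → cong (λ b → if b then weight n (toℕ i) (toℕ j) else 0)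
           (cong₂ _∧_ (mask-lookup S i)
                      (trans (lookup-map j not S) (cong not (mask-lookup S j)))))) ⟩
  sumTo M (λ x → sumTo M (λ y → if s x ∧ not (s y) then weight n x y else 0))
    ≡⟨ sumTo-cong M (λ x x<M → trans (row-sum n M x (λ y → s x ∧ not (s y)) x<M)
         (trans (cong (λ r → boundary x + r) (no-loop (s x) (n ≤ᵇ x))) (+-identityʳ _))) ⟩
  sumTo M boundary
    ≡⟨ sumTo-+ M _ _ ⟩
  sumTo M (λ x → left x (λ y → ind (s x ∧ not (s y)))) + sumTo M (λ x → right x M (λ y → ind (s x ∧ not (s y))))
    ≡⟨ cong₂ _+_ (sum-left M (λ x y → ind (s x ∧ not (s y))))
                 (sum-right M (λ x y → ind (s x ∧ not (s y)))) ⟩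
  sumTo (pred M) (λ x → ind (s (suc x) ∧ not (s x))) + sumTo (pred M) (λ x → ind (s x ∧ not (s (suc x))))
    ≡⟨ sym (sumTo-+ (pred M) _ _) ⟩
  crossings s (pred M) ∎
  where
  open ≡-Reasoning
  M = n + k
  s = mask S
  boundary : ℕ → ℕ
  boundary x = left x (λ y → ind (s x ∧ not (s y))) + right x M (λ y → ind (s x ∧ not (s y)))
  no-loop : ∀ a l → ind ((a ∧ not a) ∧ l) ≡ 0
  no-loop true  l = refl
  no-loop false l = refl

crossing-cases : ∀ a b → (crossing a b ≡ 0 × b ≡ a) ⊎ (crossing a b ≡ 1 × b ≡ not a)
crossing-cases true  true  = inj₁ (refl , refl)
crossing-cases true  false = inj₂ (refl , refl)
crossing-cases false true  = inj₂ (refl , refl)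
crossing-cases false false = inj₁ (refl , refl)

no-crossing⇒constant : ∀ m (s : ℕ → Bool) → crossings s m ≡ 0 → ∀ i → i ≤ m → s i ≡ s 0
no-crossing⇒constant m       s none zero    _         = refl
no-crossing⇒constant (suc m) s none (suc i) (s≤s i≤m) with crossing-cases (s 0) (s 1)
... | inj₁ (_ , s1≡s0) =
  trans (no-crossing⇒constant m (λ x → s (suc x)) (m+n≡0⇒n≡0 (crossing (s 0) (s 1)) none) i i≤m) s1≡s0
... | inj₂ (one , _) with () ← trans (sym (cong (λ r → r + crossings (λ x → s (suc x)) m) one)) none

step : Bool → ℕ → ℕ → Bool
step b t i = if i <ᵇ suc t then b else not b

step-true : ∀ t x → step true t x ≡ (x <ᵇ suc t)
step-true t x with x <ᵇ suc t
... | true  = refl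
... | false = refl

not-step-false : ∀ t x → not (step false t x) ≡ (x <ᵇ suc t)
not-step-false t x with x <ᵇ suc t
... | true  = refl
... | false = refl

one-crossing⇒step : ∀ m (s : ℕ → Bool) → crossings s m ≡ 1 →
  Σ ℕ (λ t → t < m × (∀ i → i ≤ m → s i ≡ step (s 0) t i))
one-crossing⇒step (suc m) s once with crossing-cases (s 0) (s 1)
... | inj₁ (none , s1≡s0)
  with t , t<m , s'≡step ← one-crossing⇒step m (λ x → s (suc x))
                             (trans (sym (cong (λ r → r + crossings (λ x → s (suc x)) m) none)) once)
  = suc t , s≤s t<m , shape
  where
  shape : ∀ i → i ≤ suc m → s i ≡ step (s 0) (suc t) i
  shape zero    _         = refl
  shape (suc i) (s≤s i≤m) = trans (s'≡step i i≤m) (cong (λ b → step b t i) s1≡s0)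
... | inj₂ (one , s1≡¬s0) = 0 , s≤s z≤n , shape
  where
  rest : crossings (λ x → s (suc x)) m ≡ 0
  rest = cong pred (trans (sym (cong (λ r → r + crossings (λ x → s (suc x)) m) one)) once)
  shape : ∀ i → i ≤ suc m → s i ≡ step (s 0) 0 i
  shape zero    _         = refl
  shape (suc i) (s≤s i≤m) = trans (no-crossing⇒constant m (λ x → s (suc x)) rest i i≤m) s1≡¬s0

prefixVol : ℕ → ℕ → ℕ → ℕ
prefixVol n k j = sumTo j (degree n (n + k))

sum-loops : ∀ n j → sumTo j (λ x → ind (n ≤ᵇ x)) ≡ j ∸ n
sum-loops zero    j       = sumTo-const1 j
sum-loops (suc n) zero    = refl
sum-loops (suc n) (suc j) = trans (cong (λ r → 0 + r) (shift n j)) (sum-loops n j)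
  where
  shift : ∀ n j → sumTo j (λ x → ind (suc n ≤ᵇ suc x)) ≡ sumTo j (λ x → ind (n ≤ᵇ x))
  shift zero    j = refl
  shift (suc n) j = refl

sum-right-inner : ∀ m j → j < m → sumTo j (λ x → right x m (λ _ → 1)) ≡ j
sum-right-inner m j j<m =
  trans (sumTo-cong j (λ x x<j → has-right x (≤-<-trans x<j j<m))) (sumTo-const1 j)
  where
  has-right : ∀ x → suc x < m → right x m (λ _ → 1) ≡ 1
  has-right x sx<m = cong (λ b → if b then 1 else 0) (<ᵇ-true sx<m)

sum-right-all : ∀ m → sumTo m (λ x → right x m (λ _ → 1)) ≡ pred m
sum-right-all zero    = refl
sum-right-all (suc m) = begin
  sumTo (suc m) (λ x → right x (suc m) (λ _ → 1))
    ≡⟨ sumTo-snoc m _ ⟩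
  sumTo m (λ x → right x (suc m) (λ _ → 1)) + right m (suc m) (λ _ → 1)
    ≡⟨ cong₂ _+_ (sum-right-inner (suc m) m ≤-refl) (cong (λ b → if b then 1 else 0) (<ᵇ-false {m} ≤-refl)) ⟩
  m + 0
    ≡⟨ +-identityʳ m ⟩
  m ∎
  where
  open ≡-Reasoning

sumTo-degree : ∀ n m j → sumTo j (degree n m)
  ≡ sumTo j (λ x → left x (λ _ → 1)) + sumTo j (λ x → right x m (λ _ → 1)) + sumTo j (λ x → ind (n ≤ᵇ x))
sumTo-degree n m j = trans (sumTo-+ j _ _) (cong (λ r → r + _) (sumTo-+ j _ _))

prefixVol-formula : ∀ n k j → j < n + k → prefixVol n k j ≡ pred j + j + (j ∸ n)
prefixVol-formula n k j j<M = begin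
  prefixVol n k j
    ≡⟨ sumTo-degree n (n + k) j ⟩
  sumTo j (λ x → left x (λ _ → 1)) + sumTo j (λ x → right x (n + k) (λ _ → 1)) + sumTo j loops
    ≡⟨ cong₂ (λ l r → l + r + sumTo j loops)
         (trans (sum-left j (λ _ _ → 1)) (sumTo-const1 (pred j))) (sum-right-inner (n + k) j j<M) ⟩
  pred j + j + sumTo j loops
    ≡⟨ cong (λ r → pred j + j + r) (sum-loops n j) ⟩
  pred j + j + (j ∸ n) ∎
  where
  open ≡-Reasoning
  loops : ℕ → ℕ
  loops x = ind (n ≤ᵇ x)

totalVol-formula : ∀ n k → prefixVol n k (n + k) ≡ pred (n + k) + pred (n + k) + k
totalVol-formula n k = begin
  prefixVol n k (n + k)
    ≡⟨ sumTo-degree n M M ⟩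
  sumTo M (λ x → left x (λ _ → 1)) + sumTo M (λ x → right x M (λ _ → 1)) + sumTo M (λ x → ind (n ≤ᵇ x))
    ≡⟨ cong₂ (λ l r → l + r + sumTo M (λ x → ind (n ≤ᵇ x)))
         (trans (sum-left M (λ _ _ → 1)) (sumTo-const1 (pred M))) (sum-right-all M) ⟩
  pred M + pred M + sumTo M (λ x → ind (n ≤ᵇ x))
    ≡⟨ cong (λ r → pred M + pred M + r) (trans (sum-loops n M) (m+n∸m≡n n k)) ⟩
  pred M + pred M + k ∎
  where
  open ≡-Reasoning
  M = n + k

degree-pos : ∀ n m x → 2 ≤ m → 1 ≤ degree n m x
degree-pos n (suc (suc m)) zero    _           = s≤s z≤n
degree-pos n (suc zero)    zero    (s≤s ())
degree-pos n m             (suc x) _           = s≤s z≤n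

vol-complement : ∀ n k (S : Subset (n + k)) → vol (P n k) S + vol (P n k) (∁ S) ≡ prefixVol n k (n + k)
vol-complement n k S = trans (cong₂ _+_ (vol-formula n k S) (vol-formula n k (∁ S)))
  (sumTo-split (n + k) (mask S) (mask (∁ S)) (degree n (n + k)) (mask-∁ S))

vol-pos : ∀ n k (S : Subset (n + k)) → 2 ≤ n + k → Nonempty S → 1 ≤ vol (P n k) S
vol-pos n k S M≥2 (i , i∈S) = begin
  1                                                          ≤⟨ degree-pos n M x M≥2 ⟩
  degree n M x                                               ≡⟨ cong (λ b → if b then degree n M x else 0) (sym x∈S) ⟩
  (if mask S x then degree n M x else 0)                     ≤⟨ term≤sumTo (λ y → if mask S y then degree n M y else 0) x (toℕ<n i) ⟩
  sumTo M (λ y → if mask S y then degree n M y else 0)       ≡⟨ sym (vol-formula n k S) ⟩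
  vol (P n k) S ∎
  where
  open ≤-Reasoning
  M = n + k
  x = toℕ i
  x∈S : mask S x ≡ true
  x∈S = mask-∈ S i∈S

vol-prefix : ∀ n k (S : Subset (n + k)) j → j ≤ n + k →
  (∀ x → x < n + k → mask S x ≡ (x <ᵇ j)) → vol (P n k) S ≡ prefixVol n k j
vol-prefix n k S j j≤M S≗prefix = begin
  vol (P n k) S
    ≡⟨ vol-formula n k S ⟩
  sumTo (n + k) (λ x → if mask S x then degree n (n + k) x else 0)
    ≡⟨ sumTo-cong (n + k) (λ x x<M → cong (λ b → if b then degree n (n + k) x else 0) (S≗prefix x x<M)) ⟩
  sumTo (n + k) (λ x → if x <ᵇ j then degree n (n + k) x else 0)
    ≡⟨ sumTo-below (n + k) j (degree n (n + k)) j≤M ⟩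
  prefixVol n k j ∎
  where open ≡-Reasoning

-- A proper subset is left by at least one edge: a mask taking both values crosses.
cut-pos : ∀ n k (S : Subset (n + k)) → Proper S → 1 ≤ cut (P n k) S (∁ S)
cut-pos n k S ((i , i∈S) , (j , j∉S)) with cut (P n k) S (∁ S) in eq
... | suc _ = s≤s z≤n
... | zero  = ⊥-elim (true≢false (begin
    true              ≡⟨ sym (mask-∈ S i∈S) ⟩
    mask S (toℕ i)    ≡⟨ constant (toℕ i) (<⇒≤pred (toℕ<n i)) ⟩
    mask S 0          ≡⟨ sym (constant (toℕ j) (<⇒≤pred (toℕ<n j))) ⟩
    mask S (toℕ j)    ≡⟨ mask-∉ S j∉S ⟩
    false             ∎))
  where
  open ≡-Reasoning
  constant = no-crossing⇒constant (pred (n + k)) (mask S) (trans (sym (cut-formula n k S)) eq)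
  true≢false : true ≢ false
  true≢false ()

PrefixSplit : ℕ → ℕ → ℕ → ℕ → Set
PrefixSplit n k a b = Σ ℕ (λ j → 1 ≤ j × j < n + k × (a ≡ prefixVol n k j ⊎ b ≡ prefixVol n k j))

single-edge-cut : ∀ n k → 2 ≤ n + k → (S : Subset (n + k)) → cut (P n k) S (∁ S) ≡ 1 →
  PrefixSplit n k (vol (P n k) S) (vol (P n k) (∁ S))
single-edge-cut n k M≥2 S once
  with t , t<pM , s≗step ← one-crossing⇒step (pred (n + k)) (mask S) (trans (sym (cut-formula n k S)) once)
  = suc t , s≤s z≤n , st<M , which-side (mask S 0) refl
  where
  open ≡-Reasoning
  s = mask S
  st<M : suc t < n + k
  st<M = m≤pred[n]⇒suc[m]≤n {{>-nonZero (≤-trans (s≤s z≤n) M≥2)}} t<pM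
  which-side : ∀ b → s 0 ≡ b → vol (P n k) S ≡ prefixVol n k (suc t) ⊎ vol (P n k) (∁ S) ≡ prefixVol n k (suc t)
  which-side true  s0 = inj₁ (vol-prefix n k S (suc t) (<⇒≤ st<M) (λ x x<M → begin
    s x                  ≡⟨ s≗step x (<⇒≤pred x<M) ⟩
    step (s 0) t x       ≡⟨ cong (λ b → step b t x) s0 ⟩
    step true t x        ≡⟨ step-true t x ⟩
    (x <ᵇ suc t)         ∎))
  which-side false s0 = inj₂ (vol-prefix n k (∁ S) (suc t) (<⇒≤ st<M) (λ x x<M → begin
    mask (∁ S) x         ≡⟨ mask-∁ S x x<M ⟩
    not (s x)            ≡⟨ cong not (s≗step x (<⇒≤pred x<M)) ⟩
    not (step (s 0) t x) ≡⟨ cong (λ b → not (step b t x)) s0 ⟩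
    not (step false t x) ≡⟨ not-step-false t x ⟩
    (x <ᵇ suc t)         ∎))

-- What the computation of Mcut needs to know about a proper subset S, with
-- a = vol S, b = vol (V∖S) and c = cut(S, V∖S).
record CutProfile (n k a b c : ℕ) : Set where
  field
    volumes  : a + b ≡ prefixVol n k (n + k)
    a≥1      : 1 ≤ a
    b≥1      : 1 ≤ b
    c≥1      : 1 ≤ c
    one-edge : c ≡ 1 → PrefixSplit n k a b

cutProfile : ∀ n k → 2 ≤ n + k → (S : Subset (n + k)) → Proper S →
  CutProfile n k (vol (P n k) S) (vol (P n k) (∁ S)) (cut (P n k) S (∁ S))
cutProfile n k M≥2 S proper@(S≠∅ , ∁S≠∅) = record
  { volumes  = vol-complement n k S
  ; a≥1      = vol-pos n k S M≥2 S≠∅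
  ; b≥1      = vol-pos n k (∁ S) M≥2 ∁S≠∅
  ; c≥1      = cut-pos n k S proper
  ; one-edge = single-edge-cut n k M≥2 S
  }

prefixSet : ∀ {m} → ℕ → Subset m
prefixSet j = tabulate (λ i → toℕ i <ᵇ j)

mask-tabulate : ∀ {m} (g : ℕ → Bool) x → x < m → mask (tabulate {n = m} (λ i → g (toℕ i))) x ≡ g x
mask-tabulate {suc m} g zero    _         = refl
mask-tabulate {suc m} g (suc x) (s≤s x<m) = mask-tabulate {m} (λ y → g (suc y)) x x<m

crossings-prefix : ∀ m j → 1 ≤ j → j ≤ m → crossings (λ x → x <ᵇ j) m ≡ 1
crossings-prefix (suc m) (suc zero)    _ _         = cong suc (sumTo-zero m (λ _ → refl))
crossings-prefix (suc m) (suc (suc j)) _ (s≤s j≤m) = crossings-prefix m (suc j) (s≤s z≤n) j≤m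

prefixSet-cut : ∀ n k j → 1 ≤ j → j < n + k →
  Proper (prefixSet {n + k} j) × vol (P n k) (prefixSet j) ≡ prefixVol n k j × cut (P n k) (prefixSet j) (∁ (prefixSet j)) ≡ 1
prefixSet-cut n k j j≥1 j<M =
  ((first , lookup⇒[]= first S first∈S) , (fromℕ< j<M , lookup⇒[]= (fromℕ< j<M) (∁ S) j∉S)) ,
  vol-prefix n k S j (<⇒≤ j<M) S≗prefix ,
  (begin
    cut (P n k) S (∁ S)                    ≡⟨ cut-formula n k S ⟩
    crossings (mask S) (pred M)            ≡⟨ sumTo-cong (pred M) (λ x x<pM → cong₂ crossing
                                                (S≗prefix x (≤-<-trans (n≤1+n x) (pred<M x<pM)))
                                                (S≗prefix (suc x) (pred<M x<pM))) ⟩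
    crossings (λ x → x <ᵇ j) (pred M)      ≡⟨ crossings-prefix (pred M) j j≥1 (<⇒≤pred j<M) ⟩
    1                                      ∎)
  where
  open ≡-Reasoning
  M = n + k
  S : Subset M
  S = prefixSet j
  S≗prefix : ∀ x → x < M → mask S x ≡ (x <ᵇ j)
  S≗prefix = mask-tabulate (λ x → x <ᵇ j)
  pred<M : ∀ {x} → x < pred M → suc x < M
  pred<M = m≤pred[n]⇒suc[m]≤n {{>-nonZero (≤-<-trans z≤n j<M)}}
  first : Fin M
  first = fromℕ< (≤-<-trans z≤n j<M)
  first∈S : lookup S first ≡ true
  first∈S = begin
    lookup S first           ≡⟨ mask-lookup S first ⟩
    mask S (toℕ first)       ≡⟨ S≗prefix (toℕ first) (toℕ<n first) ⟩
    (toℕ first <ᵇ j)         ≡⟨ cong (_<ᵇ j) (toℕ-fromℕ< _) ⟩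
    (0 <ᵇ j)                 ≡⟨ <ᵇ-true j≥1 ⟩
    true                     ∎
  j∉S : lookup (∁ S) (fromℕ< j<M) ≡ true
  j∉S = begin
    lookup (∁ S) (fromℕ< j<M)          ≡⟨ lookup-map (fromℕ< j<M) not S ⟩
    not (lookup S (fromℕ< j<M))        ≡⟨ cong not (mask-lookup S (fromℕ< j<M)) ⟩
    not (mask S (toℕ (fromℕ< j<M)))    ≡⟨ cong not (S≗prefix _ (toℕ<n (fromℕ< j<M))) ⟩
    not (toℕ (fromℕ< j<M) <ᵇ j)        ≡⟨ cong (λ x → not (x <ᵇ j)) (toℕ-fromℕ< j<M) ⟩
    not (j <ᵇ j)                       ≡⟨ cong not (<ᵇ-false {j} ≤-refl) ⟩
    true                               ∎

ncutValue : ℕ → ℕ → ℕ → ℚ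
ncutValue c a b = (+ c ℚ./ 1) ℚ.* (frac (+ 1) a ℚ.+ frac (+ 1) b)

-- The same value, unnormalised, for a = a' + 1 and b = b' + 1.
ncutᵘ : ℕ → ℕ → ℕ → ℚᵘ
ncutᵘ c a' b' = mkℚᵘ (+ c) 0 ᵘ.* (mkℚᵘ (+ 1) a' ᵘ.+ mkℚᵘ (+ 1) b')

toℚᵘ-ncutValue : ∀ c a' b' → toℚᵘ (ncutValue c (suc a') (suc b')) ᵘ.≃ ncutᵘ c a' b'
toℚᵘ-ncutValue c a' b' = ᵘP.≃-trans (ℚP.toℚᵘ-homo-* (+ c ℚ./ 1) _)
  (ᵘP.*-cong (ℚP.toℚᵘ-fromℚᵘ (mkℚᵘ (+ c) 0))
    (ᵘP.≃-trans (ℚP.toℚᵘ-homo-+ (+ 1 ℚ./ suc a') (+ 1 ℚ./ suc b'))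
      (ᵘP.+-cong (ℚP.toℚᵘ-fromℚᵘ (mkℚᵘ (+ 1) a')) (ℚP.toℚᵘ-fromℚᵘ (mkℚᵘ (+ 1) b')))))

↥ncutᵘ : ∀ c a' b' → ᵘ.↥ ncutᵘ c a' b' ≡ + (c * (suc a' + suc b'))
↥ncutᵘ c a' b' = begin
  + c ℤ.* (+ 1 ℤ.* + suc b' ℤ.+ + 1 ℤ.* + suc a')
    ≡⟨ cong (+ c ℤ.*_) (cong₂ ℤ._+_ (ℤP.*-identityˡ (+ suc b')) (ℤP.*-identityˡ (+ suc a'))) ⟩
  + c ℤ.* (+ suc b' ℤ.+ + suc a')
    ≡⟨ cong (+ c ℤ.*_) (sym (ℤP.pos-+ (suc b') (suc a'))) ⟩
  + c ℤ.* + (suc b' + suc a')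
    ≡⟨ sym (ℤP.pos-* c _) ⟩
  + (c * (suc b' + suc a'))
    ≡⟨ cong (λ x → + (c * x)) (+-comm (suc b') (suc a')) ⟩
  + (c * (suc a' + suc b')) ∎
  where open ≡-Reasoning

↧ncutᵘ : ∀ c a' b' → ᵘ.↧ ncutᵘ c a' b' ≡ + (suc a' * suc b')
↧ncutᵘ c a' b' = cong +_ (*-identityˡ (suc a' * suc b'))

cross-left : ∀ N c a' b' → + N ℤ.* ᵘ.↧ ncutᵘ c a' b' ≡ + (N * (suc a' * suc b'))
cross-left N c a' b' = trans (cong (+ N ℤ.*_) (↧ncutᵘ c a' b')) (sym (ℤP.pos-* N _))

cross-right : ∀ D' c a' b' → ᵘ.↥ ncutᵘ c a' b' ℤ.* + suc D' ≡ + (c * (suc a' + suc b') * suc D')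
cross-right D' c a' b' = trans (cong (ℤ._* + suc D') (↥ncutᵘ c a' b')) (sym (ℤP.pos-* (c * (suc a' + suc b')) (suc D')))

ncutValue-≥ : ∀ N D c a b → 1 ≤ a → 1 ≤ b → 1 ≤ D →
  N * (a * b) ≤ c * (a + b) * D → frac (+ N) D ℚ.≤ ncutValue c a b
ncutValue-≥ N (suc D') c (suc a') (suc b') _ _ _ cross =
  ℚP.toℚᵘ-cancel-≤ (ᵘP.≤-respˡ-≃ (ᵘP.≃-sym (ℚP.toℚᵘ-fromℚᵘ (mkℚᵘ (+ N) D')))
    (ᵘP.≤-respʳ-≃ (ᵘP.≃-sym (toℚᵘ-ncutValue c a' b'))
      (ᵘ.*≤* (subst₂ ℤ._≤_ (sym (cross-left N c a' b')) (sym (cross-right D' c a' b')) (ℤ.+≤+ cross)))))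

ncutValue-≡ : ∀ N D c a b → 1 ≤ a → 1 ≤ b → 1 ≤ D →
  N * (a * b) ≡ c * (a + b) * D → ncutValue c a b ≡ frac (+ N) D
ncutValue-≡ N (suc D') c (suc a') (suc b') _ _ _ cross =
  ℚP.toℚᵘ-injective (ᵘP.≃-trans (toℚᵘ-ncutValue c a' b')
    (ᵘP.≃-trans (ᵘ.*≡* (trans (cross-right D' c a' b') (trans (cong +_ (sym cross)) (sym (cross-left N c a' b')))))
      (ᵘP.≃-sym (ℚP.toℚᵘ-fromℚᵘ (mkℚᵘ (+ N) D')))))

frac-cross : ∀ N D N' D' → 1 ≤ D → 1 ≤ D' → N * D' ≡ N' * D → frac (+ N) D ≡ frac (+ N') D'
frac-cross N (suc d) N' (suc d') _ _ cross =
  ℚP.toℚᵘ-injective (ᵘP.≃-trans (ℚP.toℚᵘ-fromℚᵘ (mkℚᵘ (+ N) d))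
    (ᵘP.≃-trans (ᵘ.*≡* (trans (sym (ℤP.pos-* N (suc d'))) (trans (cong +_ cross) (ℤP.pos-* N' (suc d)))))
      (ᵘP.≃-sym (ℚP.toℚᵘ-fromℚᵘ (mkℚᵘ (+ N') d')))))

¬∣-remainder : ∀ d q r {x} → 0 < r → r < d → x ≡ q * d + r → ¬ (d ∣ x)
¬∣-remainder d q r r>0 r<d refl d∣x =
  <⇒≱ r<d (∣⇒≤ {{>-nonZero r>0}} (∣m+n∣m⇒∣n d∣x (n∣m*n q)))

square-of-sum : ∀ a b → Σ ℕ (λ m → Σ ℕ (λ e →
  a + b ≡ 2 * m + e × (a + b) * (a + b) ≡ 4 * (a * b) + e * e × (e ≡ 0 → a ≡ b)))
square-of-sum a b with ≤-total a b
... | inj₁ a≤b with e , refl ← m≤n⇒∃[o]m+o≡n a≤b =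
  a , e , sum-form a e , square-form a e , λ { refl → sym (+-identityʳ a) }
  where
  sum-form : ∀ a e → a + (a + e) ≡ 2 * a + e
  sum-form = solve-∀
  square-form : ∀ a e → (a + (a + e)) * (a + (a + e)) ≡ 4 * (a * (a + e)) + e * e
  square-form = solve-∀
... | inj₂ b≤a with e , refl ← m≤n⇒∃[o]m+o≡n b≤a =
  b , e , sum-form b e , square-form b e , λ { refl → +-identityʳ b }
  where
  sum-form : ∀ b e → b + e + b ≡ 2 * b + e
  sum-form = solve-∀
  square-form : ∀ b e → (b + e + b) * (b + e + b) ≡ 4 * ((b + e) * b) + e * e
  square-form = solve-∀

am-gm : ∀ a b → 4 * (a * b) ≤ (a + b) * (a + b)
am-gm a b with _ , e , _ , square , _ ← square-of-sum a b =
  subst (4 * (a * b) ≤_) (sym square) (m≤m+n _ _)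

-- If a + b is odd then a ≠ b, and 4ab + 1 ≤ (a + b)².
am-gm-odd : ∀ a b x → a + b ≡ x * 2 + 1 → 4 * (a * b) + 1 ≤ (a + b) * (a + b)
am-gm-odd a b x odd with square-of-sum a b
... | m , zero  , sum , _      , _ = ⊥-elim (¬∣-remainder 2 x 1 (s≤s z≤n) ≤-refl odd
                                      (divides m (trans sum (trans (+-identityʳ (2 * m)) (*-comm 2 m)))))
... | _ , suc e , _   , square , _ = subst (4 * (a * b) + 1 ≤_) (sym square) (+-monoʳ-≤ (4 * (a * b)) (s≤s z≤n))

-- If a + b is even and a ≠ b then |a - b| ≥ 2, so 4ab + 4 ≤ (a + b)².
am-gm-even : ∀ a b x → a + b ≡ x * 2 → a ≢ b → 4 * (a * b) + 4 ≤ (a + b) * (a + b)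
am-gm-even a b x even a≢b with square-of-sum a b
... | _ , zero        , _   , _      , e≡0⇒a≡b = ⊥-elim (a≢b (e≡0⇒a≡b refl))
... | m , suc zero    , sum , _      , _        = ⊥-elim (¬∣-remainder 2 m 1 (s≤s z≤n) ≤-refl
                                                     (trans sum (cong (_+ 1) (*-comm 2 m))) (divides x even))
... | _ , suc (suc e) , _   , square , _        = subst (4 * (a * b) + 4 ≤_) (sym square)
  (+-monoʳ-≤ (4 * (a * b)) (*-mono-≤ {2} {suc (suc e)} (s≤s (s≤s z≤n)) (s≤s (s≤s z≤n))))

-- For a + b = W and c ≥ 1 crossing edges: if single-edge cuts obey 4ab ≤ B and
-- W² ≤ 2B, then 4ab ≤ cB (cuts with c ≥ 2 edges are controlled by AM-GM alone).
product-bound : ∀ a b c W B → a + b ≡ W → 1 ≤ c →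
  (c ≡ 1 → 4 * (a * b) ≤ B) → W * W ≤ 2 * B → 4 * (a * b) ≤ c * B
product-bound a b (suc zero)    W B _    _ one-edge _     =
  subst (4 * (a * b) ≤_) (sym (+-identityʳ B)) (one-edge refl)
product-bound a b (suc (suc c)) W B refl _ _        W²≤2B = begin
  4 * (a * b)           ≤⟨ am-gm a b ⟩
  (a + b) * (a + b)     ≤⟨ W²≤2B ⟩
  2 * B                 ≤⟨ *-monoˡ-≤ B {2} {suc (suc c)} (s≤s (s≤s z≤n)) ⟩
  suc (suc c) * B       ∎
  where open ≤-Reasoning

mcut-by-prefix : ∀ n k N D j → 2 ≤ n + k → 1 ≤ D → 1 ≤ j → j < n + k →
  (∀ a b c → CutProfile n k a b c → N * (a * b) ≤ c * (a + b) * D) →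
  (∀ b → prefixVol n k j + b ≡ prefixVol n k (n + k) → N * (prefixVol n k j * b) ≡ (prefixVol n k j + b) * D) →
  IsMcut (P n k) (frac (+ N) D)
mcut-by-prefix n k N D j M≥2 D≥1 j≥1 j<M lower attained =
  (S , proper , attained-value) , λ T T-proper → bound T T-proper (cutProfile n k M≥2 T T-proper)
  where
  S = prefixSet {n + k} j
  a = vol (P n k) S
  b = vol (P n k) (∁ S)
  π = prefixVol n k j
  facts = prefixSet-cut n k j j≥1 j<M
  proper = proj₁ facts
  a≡π : a ≡ π
  a≡π = proj₁ (proj₂ facts)
  open CutProfile
  profile = cutProfile n k M≥2 S proper
  cross : N * (a * b) ≡ 1 * (a + b) * D
  cross = begin
    N * (a * b)          ≡⟨ cong (λ x → N * (x * b)) a≡π ⟩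
    N * (π * b)          ≡⟨ attained b (trans (cong (_+ b) (sym a≡π)) (volumes profile)) ⟩
    (π + b) * D          ≡⟨ cong (λ x → (x + b) * D) (sym a≡π) ⟩
    (a + b) * D          ≡⟨ cong (_* D) (sym (*-identityˡ (a + b))) ⟩
    1 * (a + b) * D      ∎
    where open ≡-Reasoning
  attained-value : Ncut (P n k) S (∁ S) ≡ frac (+ N) D
  attained-value = trans (cong (λ c → ncutValue c a b) (proj₂ (proj₂ facts)))
                         (ncutValue-≡ N D 1 a b (a≥1 profile) (b≥1 profile) D≥1 cross)
  bound : ∀ T → Proper T → CutProfile n k (vol (P n k) T) (vol (P n k) (∁ T)) (cut (P n k) T (∁ T)) →
    frac (+ N) D ℚ.≤ Ncut (P n k) T (∁ T)
  bound T _ p = ncutValue-≥ N D (cut (P n k) T (∁ T)) (vol (P n k) T) (vol (P n k) (∁ T))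
                  (a≥1 p) (b≥1 p) D≥1 (lower _ _ _ p)

-- Mcut(P n k) is attained by a prefix {x_1, …, x_j} of volume a (complement
-- volume b) as soon as it is the most balanced single-edge cut and W² ≤ 8ab
-- for W = a + b = vol V; its value is then 4W/(4ab) = W/(ab).
mcut-most-balanced : ∀ n k j a b → 2 ≤ n + k → 1 ≤ j → j < n + k → 1 ≤ a → 1 ≤ b →
  prefixVol n k j ≡ a → a + b ≡ prefixVol n k (n + k) →
  (∀ a' b' c → CutProfile n k a' b' c → c ≡ 1 → 4 * (a' * b') ≤ 4 * (a * b)) →
  (a + b) * (a + b) ≤ 2 * (4 * (a * b)) →
  IsMcut (P n k) (frac (+ (4 * (a + b))) (4 * (a * b)))
mcut-most-balanced n k j a b M≥2 j≥1 j<M a≥1 b≥1 π≡a a+b≡W single-edge W²≤8ab =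
  mcut-by-prefix n k (4 * W) (4 * (a * b)) j M≥2 D≥1 j≥1 j<M lower attained
  where
  W = a + b
  D≥1 : 1 ≤ 4 * (a * b)
  D≥1 = *-mono-≤ {1} {4} (s≤s z≤n) (*-mono-≤ a≥1 b≥1)
  lower : ∀ a' b' c → CutProfile n k a' b' c → 4 * W * (a' * b') ≤ c * (a' + b') * (4 * (a * b))
  lower a' b' c p = begin
    4 * W * (a' * b')            ≡⟨ *-assoc-swap 4 W (a' * b') ⟩
    W * (4 * (a' * b'))          ≤⟨ *-monoʳ-≤ W (product-bound a' b' c W (4 * (a * b)) a'+b'≡W
                                      (CutProfile.c≥1 p) (single-edge a' b' c p) W²≤8ab) ⟩
    W * (c * (4 * (a * b)))      ≡⟨ sym (*-assoc-swap c W (4 * (a * b))) ⟩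
    c * W * (4 * (a * b))        ≡⟨ cong (λ x → c * x * (4 * (a * b))) (sym a'+b'≡W) ⟩
    c * (a' + b') * (4 * (a * b)) ∎
    where
    open ≤-Reasoning
    a'+b'≡W : a' + b' ≡ W
    a'+b'≡W = trans (CutProfile.volumes p) (sym a+b≡W)
    *-assoc-swap : ∀ x y z → x * y * z ≡ y * (x * z)
    *-assoc-swap = solve-∀
  attained : ∀ b' → prefixVol n k j + b' ≡ prefixVol n k (n + k) →
    4 * W * (prefixVol n k j * b') ≡ (prefixVol n k j + b') * (4 * (a * b))
  attained b' a+b'≡W rewrite π≡a | +-cancelˡ-≡ a b' b (trans a+b'≡W (sym a+b≡W)) = exchange a b
    where
    exchange : ∀ a b → 4 * (a + b) * (a * b) ≡ (a + b) * (4 * (a * b))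
    exchange = solve-∀

vol-P2kk : ∀ k → 1 ≤ k → prefixVol (2 * k) k (2 * k + k) + 2 ≡ 7 * k
vol-P2kk (suc k) _ = begin
  prefixVol (2 * suc k) (suc k) (2 * suc k + suc k) + 2
    ≡⟨ cong (_+ 2) (totalVol-formula (2 * suc k) (suc k)) ⟩
  pred (2 * suc k + suc k) + pred (2 * suc k + suc k) + suc k + 2
    ≡⟨ cong (λ m → pred m + pred m + suc k + 2) (vertices k) ⟩
  (3 * k + 2) + (3 * k + 2) + suc k + 2
    ≡⟨ volume k ⟩
  7 * suc k ∎
  where
  open ≡-Reasoning
  vertices : ∀ k → 2 * suc k + suc k ≡ suc (3 * k + 2)
  vertices = solve-∀
  volume : ∀ k → (3 * k + 2) + (3 * k + 2) + suc k + 2 ≡ 7 * suc k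
  volume = solve-∀

-- The first j ≤ 2k vertices carry no loop, so their volume 2j − 1 is odd.
prefixVol-small : ∀ k t → t < 2 * k → prefixVol (2 * k) k (suc t) ≡ 1 + t * 2
prefixVol-small (suc k) t t<2k = begin
  prefixVol (2 * suc k) (suc k) (suc t)        ≡⟨ prefixVol-formula (2 * suc k) (suc k) (suc t)
                                                    (<-≤-trans (s≤s t<2k) (m<m+n (2 * suc k) (s≤s z≤n))) ⟩
  t + suc t + (suc t ∸ 2 * suc k)              ≡⟨ cong (λ x → t + suc t + x) (m≤n⇒m∸n≡0 t<2k) ⟩
  t + suc t + 0                                ≡⟨ odd-form t ⟩
  1 + t * 2                                    ∎
  where
  open ≡-Reasoning
  odd-form : ∀ t → t + suc t + 0 ≡ 1 + t * 2
  odd-form = solve-∀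

prefixVol-large : ∀ k j → 2 * k < j → j < 2 * k + k → 4 * k + 1 ≤ prefixVol (2 * k) k j
prefixVol-large k j 2k<j j<3k = begin
  4 * k + 1                      ≡⟨ split-form k ⟩
  2 * k + suc (2 * k)            ≤⟨ +-mono-≤ (<⇒≤pred 2k<j) 2k<j ⟩
  pred j + j                     ≤⟨ m≤m+n (pred j + j) (j ∸ 2 * k) ⟩
  pred j + j + (j ∸ 2 * k)       ≡⟨ sym (prefixVol-formula (2 * k) k j j<3k) ⟩
  prefixVol (2 * k) k j          ∎
  where
  open ≤-Reasoning
  split-form : ∀ k → 4 * k + 1 ≡ 2 * k + suc (2 * k)
  split-form = solve-∀

-- A prefix carrying exactly half of the volume 7k − 2 lies within the first
-- 2k vertices, hence has odd volume.
half-prefix-odd : ∀ k j → j < 2 * k + k →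
  prefixVol (2 * k) k j + prefixVol (2 * k) k j + 2 ≡ 7 * k → 1 ≤ j →
  Σ ℕ (λ t → prefixVol (2 * k) k j ≡ 1 + t * 2)
half-prefix-odd k (suc t) j<3k half _ with t <? 2 * k
... | yes t<2k = t , prefixVol-small k t t<2k
... | no  t≮2k = ⊥-elim (<-irrefl refl (begin-strict
  7 * k                           <⟨ m<m+n (7 * k) {4 + k} (s≤s z≤n) ⟩
  7 * k + (4 + k)                 ≡⟨ double-form k ⟩
  (4 * k + 1) + (4 * k + 1) + 2   ≤⟨ +-monoˡ-≤ 2 (+-mono-≤ large large) ⟩
  π + π + 2                       ≡⟨ half ⟩
  7 * k                           ∎))
  where
  open ≤-Reasoning
  π = prefixVol (2 * k) k (suc t)
  large : 4 * k + 1 ≤ π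
  large = prefixVol-large k (suc t) (s≤s (≮⇒≥ t≮2k)) j<3k
  double-form : ∀ k → 7 * k + (4 + k) ≡ (4 * k + 1) + (4 * k + 1) + 2
  double-form = solve-∀

∸-exact : ∀ {m} u r → u + r ≡ m → m ∸ r ≡ u
∸-exact u r refl = m+n∸n≡m u r

profile-sum : ∀ k a b c → 1 ≤ k → CutProfile (2 * k) k a b c → a + b + 2 ≡ 7 * k
profile-sum k a b c k≥1 p = trans (cong (_+ 2) (CutProfile.volumes p)) (vol-P2kk k k≥1)

balanced-single-edge-odd : ∀ k a b c → 1 ≤ k → CutProfile (2 * k) k a b c → c ≡ 1 → a ≡ b →
  Σ ℕ (λ s → a ≡ 1 + s * 2)
balanced-single-edge-odd k a b c k≥1 p c≡1 a≡b with CutProfile.one-edge p c≡1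
... | j , j≥1 , j<3k , side = s , trans a≡π π-odd
  where
  π = prefixVol (2 * k) k j
  one-side : a ≡ π ⊎ b ≡ π → a ≡ π
  one-side (inj₁ a≡π) = a≡π
  one-side (inj₂ b≡π) = trans a≡b b≡π
  a≡π : a ≡ π
  a≡π = one-side side
  halves : π + π + 2 ≡ 7 * k
  halves = begin
    π + π + 2     ≡⟨ cong₂ (λ x y → x + y + 2) (sym a≡π) (trans (sym a≡π) a≡b) ⟩
    a + b + 2     ≡⟨ profile-sum k a b c k≥1 p ⟩
    7 * k         ∎
    where open ≡-Reasoning
  odd = half-prefix-odd k j j<3k halves j≥1
  s = proj₁ odd
  π-odd = proj₂ odd

quotient<2k : ∀ k t r → 3 ≤ r → 7 * k ≡ t * 4 + r → t < 2 * k
quotient<2k k t r r≥3 7k≡ with t <? 2 * k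
... | yes t<2k = t<2k
... | no  t≮2k = ⊥-elim (<-irrefl refl (begin-strict
  7 * k                  <⟨ m<m+n (7 * k) {3 + k} (s≤s z≤n) ⟩
  7 * k + (3 + k)        ≡⟨ eight-k k ⟩
  2 * k * 4 + 3          ≤⟨ +-mono-≤ (*-monoˡ-≤ 4 (≮⇒≥ t≮2k)) r≥3 ⟩
  t * 4 + r              ≡⟨ sym 7k≡ ⟩
  7 * k                  ∎))
  where
  open ≤-Reasoning
  eight-k : ∀ k → 7 * k + (3 + k) ≡ 2 * k * 4 + 3
  eight-k = solve-∀

-- The most balanced prefix of P_{2k,k}: the first t + 1 ≤ 2k vertices, of odd
-- volume a = 2t + 1, against a complement of volume b.
mcut-P2kk : ∀ k t b → t < 2 * k → 1 ≤ b → 1 + t * 2 + b + 2 ≡ 7 * k →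
  (∀ a' b' c → CutProfile (2 * k) k a' b' c → c ≡ 1 → 4 * (a' * b') ≤ 4 * ((1 + t * 2) * b)) →
  (1 + t * 2 + b) * (1 + t * 2 + b) ≤ 2 * (4 * ((1 + t * 2) * b)) →
  IsMcut (P (2 * k) k) (frac (+ (4 * (1 + t * 2 + b))) (4 * ((1 + t * 2) * b)))
mcut-P2kk (suc k) t b t<2k b≥1 7k≡ single-edge W²≤8ab =
  mcut-most-balanced (2 * suc k) (suc k) (suc t) (1 + t * 2) b
    (s≤s (≤-trans (s≤s z≤n) (m≤n+m (suc k) (k + 1 * suc k)))) (s≤s z≤n)
    (<-≤-trans (s≤s t<2k) (m<m+n (2 * suc k) (s≤s z≤n))) (s≤s z≤n) b≥1
    (prefixVol-small (suc k) t t<2k)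
    (+-cancelʳ-≡ 2 _ _ (trans 7k≡ (sym (vol-P2kk (suc k) (s≤s z≤n)))))
    single-edge W²≤8ab

positive : ∀ k t → t < 2 * k → 1 ≤ k
positive (suc k) _ _ = s≤s z≤n

single-edge-bound : ∀ k a b e → 1 ≤ k → a + b + 2 ≡ 7 * k → (a + b) * (a + b) ≡ 4 * (a * b) + e →
  (∀ a' b' c → CutProfile (2 * k) k a' b' c → c ≡ 1 → a' + b' ≡ a + b → 4 * (a' * b') + e ≤ (a' + b') * (a' + b')) →
  ∀ a' b' c → CutProfile (2 * k) k a' b' c → c ≡ 1 → 4 * (a' * b') ≤ 4 * (a * b)
single-edge-bound k a b e k≥1 total square gap a' b' c p c≡1 = +-cancelʳ-≤ e _ _ (begin
  4 * (a' * b') + e       ≤⟨ gap a' b' c p c≡1 same-total ⟩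
  (a' + b') * (a' + b')   ≡⟨ cong (λ W → W * W) same-total ⟩
  (a + b) * (a + b)       ≡⟨ square ⟩
  4 * (a * b) + e         ∎)
  where
  open ≤-Reasoning
  same-total : a' + b' ≡ a + b
  same-total = +-cancelʳ-≡ 2 _ _ (trans (profile-sum k a' b' c k≥1 p) (sym total))

-- k ≡ 0 (mod 4), i.e. 7k = 4t + 4: the first t + 1 vertices carry exactly half
-- of the volume, and Mcut = 4/(7k − 2).
mcut-A : ∀ k t → 7 * k ≡ t * 4 + 4 → IsMcut (P (2 * k) k) (frac (+ 4) (7 * k ∸ 2))
mcut-A k t 7k≡ = subst (IsMcut (P (2 * k) k)) value
  (mcut-P2kk k t a t<2k (s≤s z≤n) total
    (single-edge-bound k a a 0 (positive k t t<2k) total (square-form a) balanced)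
    square-le)
  where
  a = 1 + t * 2
  t<2k = quotient<2k k t 4 (s≤s (s≤s (s≤s z≤n))) 7k≡
  total-form : ∀ t → 1 + t * 2 + (1 + t * 2) + 2 ≡ t * 4 + 4
  total-form = solve-∀
  total : a + a + 2 ≡ 7 * k
  total = trans (total-form t) (sym 7k≡)
  square-form : ∀ a → (a + a) * (a + a) ≡ 4 * (a * a) + 0
  square-form = solve-∀
  balanced : ∀ a' b' c → CutProfile (2 * k) k a' b' c → c ≡ 1 → a' + b' ≡ a + a →
    4 * (a' * b') + 0 ≤ (a' + b') * (a' + b')
  balanced a' b' _ _ _ _ = subst (_≤ (a' + b') * (a' + b')) (sym (+-identityʳ _)) (am-gm a' b')
  square-le : (a + a) * (a + a) ≤ 2 * (4 * (a * a))
  square-le = subst (_≤ 2 * (4 * (a * a))) (sym (trans (square-form a) (+-identityʳ _))) (m≤m+n _ _)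
  W≡ : 7 * k ∸ 2 ≡ a + a
  W≡ = ∸-exact (a + a) 2 total
  cross-form : ∀ a → 4 * (a + a) * (a + a) ≡ 4 * (4 * (a * a))
  cross-form = solve-∀
  value : frac (+ (4 * (a + a))) (4 * (a * a)) ≡ frac (+ 4) (7 * k ∸ 2)
  value = frac-cross (4 * (a + a)) (4 * (a * a)) 4 (7 * k ∸ 2) (s≤s z≤n) (subst (1 ≤_) (sym W≡) (s≤s z≤n))
    (trans (cong (λ W → 4 * (a + a) * W) W≡) (cross-form a))

-- When 4 divides the volume 7k − 2, no single-edge cut of P_{2k,k} is balanced
-- (balanced halves would be odd), so AM-GM improves to 4ab + 4 ≤ (a + b)².
single-edge-unbalanced : ∀ k u a b c → 1 ≤ k → a + b ≡ u * 4 → CutProfile (2 * k) k a b c → c ≡ 1 →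
  4 * (a * b) + 4 ≤ (a + b) * (a + b)
single-edge-unbalanced k u a b c k≥1 a+b≡4u p c≡1 =
  am-gm-even a b (u * 2) (trans a+b≡4u (sym (*-assoc u 2 2))) λ a≡b →
    let (s , a≡odd) = balanced-single-edge-odd k a b c k≥1 p c≡1 a≡b
    in ¬∣-remainder 4 s 2 z<s (s<s (s<s z<s))
         (trans (cong₂ _+_ a≡odd (trans (sym a≡b) a≡odd)) (odd+odd s))
         (divides u a+b≡4u)
  where
  odd+odd : ∀ s → 1 + s * 2 + (1 + s * 2) ≡ s * 4 + 2
  odd+odd = solve-∀

-- The value 4W/(4ab) of the even case, written as in the statement: W = 7k − 2,
-- 2a = 7k − 4 and 2b = 7k.
value-even : ∀ k a b → a + b + 2 ≡ 7 * k → a + a + 4 ≡ 7 * k → b + b ≡ 7 * k →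
  frac (+ (4 * (a + b))) (4 * (a * b)) ≡ frac (+ (4 * (7 * k ∸ 2))) ((7 * k ∸ 4) * (7 * k))
value-even k a b total lower upper = cong₂ (λ N D → frac (+ N) D)
  (cong (4 *_) (sym (∸-exact (a + b) 2 total)))
  (sym (trans (cong₂ _*_ (∸-exact (a + a) 4 lower) (sym upper)) (product a b)))
  where
  product : ∀ a b → (a + a) * (b + b) ≡ 4 * (a * b)
  product = solve-∀

-- k ≡ 2 (mod 4), i.e. 7k = 4t + 6: no prefix carries half of the (even) volume,
-- the best one has volumes 2t + 1 and 2t + 3, and Mcut = 4(7k − 2)/((7k − 4) 7k).
mcut-B : ∀ k t → 7 * k ≡ t * 4 + 6 →
  IsMcut (P (2 * k) k) (frac (+ (4 * (7 * k ∸ 2))) ((7 * k ∸ 4) * (7 * k)))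
mcut-B k t 7k≡ = subst (IsMcut (P (2 * k) k))
  (value-even k a b total (trans (lower-form t) (sym 7k≡)) (trans (upper-form t) (sym 7k≡)))
  (mcut-P2kk k t b t<2k (s≤s z≤n) total
    (single-edge-bound k a b 4 (positive k t t<2k) total (square-form t)
      (λ a' b' c p c≡1 same → single-edge-unbalanced k (1 + t) a' b' c (positive k t t<2k)
                                 (trans same (four-form t)) p c≡1))
    square-le)
  where
  a = 1 + t * 2
  b = 3 + t * 2
  t<2k = quotient<2k k t 6 (s≤s (s≤s (s≤s z≤n))) 7k≡
  total-form : ∀ t → 1 + t * 2 + (3 + t * 2) + 2 ≡ t * 4 + 6
  total-form = solve-∀
  total : a + b + 2 ≡ 7 * k
  total = trans (total-form t) (sym 7k≡)
  four-form : ∀ t → 1 + t * 2 + (3 + t * 2) ≡ (1 + t) * 4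
  four-form = solve-∀
  square-form : ∀ t → (1 + t * 2 + (3 + t * 2)) * (1 + t * 2 + (3 + t * 2)) ≡ 4 * ((1 + t * 2) * (3 + t * 2)) + 4
  square-form = solve-∀
  slack : ∀ t → 2 * (4 * ((1 + t * 2) * (3 + t * 2)))
                ≡ (1 + t * 2 + (3 + t * 2)) * (1 + t * 2 + (3 + t * 2)) + (t * t * 16 + t * 32 + 8)
  slack = solve-∀
  square-le : (a + b) * (a + b) ≤ 2 * (4 * (a * b))
  square-le = subst ((a + b) * (a + b) ≤_) (sym (slack t)) (m≤m+n _ _)
  lower-form : ∀ t → 1 + t * 2 + (1 + t * 2) + 4 ≡ t * 4 + 6
  lower-form = solve-∀
  upper-form : ∀ t → 3 + t * 2 + (3 + t * 2) ≡ t * 4 + 6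
  upper-form = solve-∀

-- The value 4W/(4ab) of the odd case, written as in the statement: W = 7k − 2,
-- 4ab = (W − 1)(W + 1) = (7k − 3)(7k − 1).
value-odd : ∀ k a b u v → a + b + 2 ≡ 7 * k → u + 3 ≡ 7 * k → v + 1 ≡ 7 * k → u * v ≡ 4 * (a * b) →
  frac (+ (4 * (a + b))) (4 * (a * b)) ≡ frac (+ (4 * (7 * k ∸ 2))) ((7 * k ∸ 3) * (7 * k ∸ 1))
value-odd k a b u v total lower upper product = cong₂ (λ N D → frac (+ N) D)
  (cong (4 *_) (sym (∸-exact (a + b) 2 total)))
  (sym (trans (cong₂ _*_ (∸-exact u 3 lower) (∸-exact v 1 upper)) product))

-- An odd volume W = a + b with a − b = ±1: then W² = 4ab + 1 and the prefix is optimal.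
mcut-odd : ∀ k t b x → t < 2 * k → 1 ≤ b → 1 + t * 2 + b + 2 ≡ 7 * k → 1 + t * 2 + b ≡ x * 2 + 1 →
  (1 + t * 2 + b) * (1 + t * 2 + b) ≡ 4 * ((1 + t * 2) * b) + 1 →
  (1 + t * 2 + b) * (1 + t * 2 + b) ≤ 2 * (4 * ((1 + t * 2) * b)) →
  IsMcut (P (2 * k) k) (frac (+ (4 * (1 + t * 2 + b))) (4 * ((1 + t * 2) * b)))
mcut-odd k t b x t<2k b≥1 total odd square-eq square-le =
  mcut-P2kk k t b t<2k b≥1 total
    (single-edge-bound k (1 + t * 2) b 1 (positive k t t<2k) total square-eq
      (λ a' b' _ _ _ same → am-gm-odd a' b' x (trans same odd)))
    square-le

-- k ≡ 3 (mod 4), i.e. 7k = 4t + 5: the volume 4t + 3 is odd, the best prefix has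
-- volume 2t + 1 against 2t + 2, and Mcut = 4(7k − 2)/((7k − 3)(7k − 1)).
mcut-C-low : ∀ k t → 7 * k ≡ t * 4 + 5 →
  IsMcut (P (2 * k) k) (frac (+ (4 * (7 * k ∸ 2))) ((7 * k ∸ 3) * (7 * k ∸ 1)))
mcut-C-low k t 7k≡ = subst (IsMcut (P (2 * k) k)) value
  (mcut-odd k t b (1 + t * 2) t<2k (s≤s z≤n) total (odd-form t) (square-form t) square-le)
  where
  a = 1 + t * 2
  b = 2 + t * 2
  t<2k = quotient<2k k t 5 (s≤s (s≤s (s≤s z≤n))) 7k≡
  total-form : ∀ t → 1 + t * 2 + (2 + t * 2) + 2 ≡ t * 4 + 5
  total-form = solve-∀
  total : a + b + 2 ≡ 7 * k
  total = trans (total-form t) (sym 7k≡)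
  odd-form : ∀ t → 1 + t * 2 + (2 + t * 2) ≡ (1 + t * 2) * 2 + 1
  odd-form = solve-∀
  square-form : ∀ t → (1 + t * 2 + (2 + t * 2)) * (1 + t * 2 + (2 + t * 2)) ≡ 4 * ((1 + t * 2) * (2 + t * 2)) + 1
  square-form = solve-∀
  slack : ∀ t → 2 * (4 * ((1 + t * 2) * (2 + t * 2)))
                ≡ (1 + t * 2 + (2 + t * 2)) * (1 + t * 2 + (2 + t * 2)) + (t * t * 16 + t * 24 + 7)
  slack = solve-∀
  square-le : (a + b) * (a + b) ≤ 2 * (4 * (a * b))
  square-le = subst ((a + b) * (a + b) ≤_) (sym (slack t)) (m≤m+n _ _)
  value : frac (+ (4 * (a + b))) (4 * (a * b)) ≡ frac (+ (4 * (7 * k ∸ 2))) ((7 * k ∸ 3) * (7 * k ∸ 1))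
  value = value-odd k a b (a + a) (b + b) total (trans (lower t) (sym 7k≡)) (trans (upper t) (sym 7k≡)) (product a b)
    where
    lower : ∀ t → 1 + t * 2 + (1 + t * 2) + 3 ≡ t * 4 + 5
    lower = solve-∀
    upper : ∀ t → 2 + t * 2 + (2 + t * 2) + 1 ≡ t * 4 + 5
    upper = solve-∀
    product : ∀ a b → (a + a) * (b + b) ≡ 4 * (a * b)
    product = solve-∀

-- k ≡ 1 (mod 4), i.e. 7k = 4t + 7: the volume 4t + 5 is odd, the best prefix has
-- volume 2t + 3 against 2t + 2, and Mcut = 4(7k − 2)/((7k − 3)(7k − 1)).
mcut-C-high : ∀ k t → 7 * k ≡ t * 4 + 7 →
  IsMcut (P (2 * k) k) (frac (+ (4 * (7 * k ∸ 2))) ((7 * k ∸ 3) * (7 * k ∸ 1)))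
mcut-C-high k t 7k≡ = subst (IsMcut (P (2 * k) k)) value
  (mcut-odd k (suc t) b (2 + t * 2) st<2k (s≤s z≤n) total (odd-form t) (square-form t) square-le)
  where
  a = 1 + suc t * 2
  b = 2 + t * 2
  shifted : ∀ t → t * 4 + 7 ≡ suc t * 4 + 3
  shifted = solve-∀
  st<2k = quotient<2k k (suc t) 3 (s≤s (s≤s (s≤s z≤n))) (trans 7k≡ (shifted t))
  total-form : ∀ t → 1 + suc t * 2 + (2 + t * 2) + 2 ≡ t * 4 + 7
  total-form = solve-∀
  total : a + b + 2 ≡ 7 * k
  total = trans (total-form t) (sym 7k≡)
  odd-form : ∀ t → 1 + suc t * 2 + (2 + t * 2) ≡ (2 + t * 2) * 2 + 1
  odd-form = solve-∀
  square-form : ∀ t → (1 + suc t * 2 + (2 + t * 2)) * (1 + suc t * 2 + (2 + t * 2)) ≡ 4 * ((1 + suc t * 2) * (2 + t * 2)) + 1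
  square-form = solve-∀
  slack : ∀ t → 2 * (4 * ((1 + suc t * 2) * (2 + t * 2)))
                ≡ (1 + suc t * 2 + (2 + t * 2)) * (1 + suc t * 2 + (2 + t * 2)) + (t * t * 16 + t * 40 + 23)
  slack = solve-∀
  square-le : (a + b) * (a + b) ≤ 2 * (4 * (a * b))
  square-le = subst ((a + b) * (a + b) ≤_) (sym (slack t)) (m≤m+n _ _)
  value : frac (+ (4 * (a + b))) (4 * (a * b)) ≡ frac (+ (4 * (7 * k ∸ 2))) ((7 * k ∸ 3) * (7 * k ∸ 1))
  value = value-odd k a b (b + b) (a + a) total (trans (lower t) (sym 7k≡)) (trans (upper t) (sym 7k≡)) (product a b)
    where
    lower : ∀ t → 2 + t * 2 + (2 + t * 2) + 3 ≡ t * 4 + 7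
    lower = solve-∀
    upper : ∀ t → 1 + suc t * 2 + (1 + suc t * 2) + 1 ≡ t * 4 + 7
    upper = solve-∀
    product : ∀ a b → (b + b) * (a + a) ≡ 4 * (a * b)
    product = solve-∀

-- The residue of k modulo 4, represented in 1..4: k = r + 4q.
data Residue4 : ℕ → Set where
  one   : ∀ q → Residue4 (1 + q * 4)
  two   : ∀ q → Residue4 (2 + q * 4)
  three : ∀ q → Residue4 (3 + q * 4)
  four  : ∀ q → Residue4 (4 + q * 4)

residue4 : ∀ k → 1 ≤ k → Residue4 k
residue4 1 _ = one 0
residue4 2 _ = two 0
residue4 3 _ = three 0
residue4 4 _ = four 0
residue4 (suc (suc (suc (suc (suc k))))) _ with residue4 (suc k) (s≤s z≤n)
... | one   q = one   (suc q)
... | two   q = two   (suc q)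
... | three q = three (suc q)
... | four  q = four  (suc q)

Mcut-P2kk-cases : ℕ → Set
Mcut-P2kk-cases k =
  ((4 ∣ k) → IsMcut (P (2 * k) k) (frac (+ 4) (7 * k ∸ 2)))
  × ((¬ (4 ∣ k)) → (2 ∣ k) →
      IsMcut (P (2 * k) k) (frac (+ (4 * (7 * k ∸ 2))) ((7 * k ∸ 4) * (7 * k))))
  × ((¬ (2 ∣ k)) →
      IsMcut (P (2 * k) k) (frac (+ (4 * (7 * k ∸ 2))) ((7 * k ∸ 3) * (7 * k ∸ 1))))

-- In each residue class mod 4 exactly one case applies, with 7k = 4t + r for the
-- t of the corresponding lemma; the other hypotheses are refuted by divisibility.
cases-by-residue : ∀ {k} → Residue4 k → Mcut-P2kk-cases k
cases-by-residue (one q) =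
  (λ 4∣k → ⊥-elim (¬∣-remainder 4 q 1 z<s (s<s z<s) (+-comm 1 (q * 4)) 4∣k)) ,
  (λ _ 2∣k → ⊥-elim (¬∣-remainder 2 (q * 2) 1 z<s (s<s z<s) (odd-form q) 2∣k)) ,
  (λ _ → mcut-C-high (1 + q * 4) (7 * q) (seven-form q))
  where
  odd-form : ∀ q → 1 + q * 4 ≡ q * 2 * 2 + 1
  odd-form = solve-∀
  seven-form : ∀ q → 7 * (1 + q * 4) ≡ 7 * q * 4 + 7
  seven-form = solve-∀
cases-by-residue (two q) =
  (λ 4∣k → ⊥-elim (¬∣-remainder 4 q 2 z<s (s<s (s<s z<s)) (+-comm 2 (q * 4)) 4∣k)) ,
  (λ _ _ → mcut-B (2 + q * 4) (7 * q + 2) (seven-form q)) ,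
  (λ 2∤k → ⊥-elim (2∤k (divides (1 + q * 2) (even-form q))))
  where
  even-form : ∀ q → 2 + q * 4 ≡ (1 + q * 2) * 2
  even-form = solve-∀
  seven-form : ∀ q → 7 * (2 + q * 4) ≡ (7 * q + 2) * 4 + 6
  seven-form = solve-∀
cases-by-residue (three q) =
  (λ 4∣k → ⊥-elim (¬∣-remainder 4 q 3 z<s (s<s (s<s (s<s z<s))) (+-comm 3 (q * 4)) 4∣k)) ,
  (λ _ 2∣k → ⊥-elim (¬∣-remainder 2 (1 + q * 2) 1 z<s (s<s z<s) (odd-form q) 2∣k)) ,
  (λ _ → mcut-C-low (3 + q * 4) (7 * q + 4) (seven-form q))
  where
  odd-form : ∀ q → 3 + q * 4 ≡ (1 + q * 2) * 2 + 1
  odd-form = solve-∀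
  seven-form : ∀ q → 7 * (3 + q * 4) ≡ (7 * q + 4) * 4 + 5
  seven-form = solve-∀
cases-by-residue (four q) =
  (λ _ → mcut-A (4 + q * 4) (7 * q + 6) (seven-form q)) ,
  (λ 4∤k _ → ⊥-elim (4∤k (divides (1 + q) refl))) ,
  (λ 2∤k → ⊥-elim (2∤k (divides (2 + q * 2) (even-form q))))
  where
  even-form : ∀ q → 4 + q * 4 ≡ (2 + q * 2) * 2
  even-form = solve-∀
  seven-form : ∀ q → 7 * (4 + q * 4) ≡ (7 * q + 6) * 4 + 4
  seven-form = solve-∀

corollary1 : (k : ℕ) → 1 ≤ k →
    ((4 ∣ k) → IsMcut (P (2 * k) k) (frac (+ 4) (7 * k ∸ 2)))
    × ((¬ (4 ∣ k)) → (2 ∣ k) →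
        IsMcut (P (2 * k) k) (frac (+ (4 * (7 * k ∸ 2))) ((7 * k ∸ 4) * (7 * k))))
    × ((¬ (2 ∣ k)) →
        IsMcut (P (2 * k) k) (frac (+ (4 * (7 * k ∸ 2))) ((7 * k ∸ 3) * (7 * k ∸ 1))))
corollary1 k k≥1 = cases-by-residue (residue4 k k≥1)
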